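{- Let $F\colon\mathbf{Set}\to\mathbf{Set}$ be a functor such that $F2$ is finite, and let $\Lambda$ be a strongly separating set of evaluation maps $F2\to2$. For $u\in F2$ write $\Lambda_u=\{\lambda\in\Lambda\mid\lambda(u)=1\}$. Then for every $v\in F2$ and every formula $\varphi$, $$[\uparrow v]\varphi\equiv\bigvee_{u\in F2,\ v\le^F u}\Big(\bigwedge_{\lambda\in\Lambda_u}[\lambda]\varphi\wedge\bigwedge_{\lambda\in\Lambda\setminus\Lambda_u}\neg[\lambda]\varphi\Big).$$
   Context: $2=\{0,1\}$ with $0\le1$. For a preorder $\le$ on $Y$, the lifted preorder $\le^F$ on $FY$: $t_0\le^F t_1$ iff there is $t\in F(\le)$ with $F\pi_i(t)=t_i$ ($i=0,1$), $\pi_i\colon{\le}\to Y$ the projections. The cone modality $\uparrow v\colon F2\to2$ for $v\in F2$ is $\uparrow v(u)=1$ iff $v\le^F u$. A set $\Lambda$ of evaluation maps $\lambda\colon F2\to2$ is separating if for every set $X$ and $t_0\ne t_1\in FX$ there are $\lambda\in\Lambda$, $p\colon X\to2$ with $\lambda(Fp(t_0))\ne\lambda(Fp(t_1))$, and strongly separating if moreover for all $t_0\ne t_1\in F2$ some $\lambda\in\Lambda$ has $\lambda(t_0)\neq\lambda(t_1)$. Formulas: $\phi::=\bigwedge\Phi\mid\neg\phi\mid[\lambda]\phi$ for arbitrary sets $\Phi$ of formulas and evaluation maps $\lambda$ (disjunction derived); for a coalgebra $\alpha\colon X\to FX$, $[\![\phi]\!]_\alpha\colon X\to2$ interprets Boolean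 connectives as usual and $[\![[\lambda]\phi]\!]_\alpha=\lambda\circ F[\![\phi]\!]_\alpha\circ\alpha$. $\phi\equiv\psi$ means $[\![\phi]\!]_\alpha=[\![\psi]\!]_\alpha$ for all coalgebras $\alpha$. -}

module Defs where

open import Level using (0ℓ)
open import Data.Bool using (Bool; true; false; not; if_then_else_) renaming (_≤_ to _≤ᵇ_)
open import Data.Product using (Σ; _×_; _,_; proj₁; proj₂)
open import Data.Nat using (ℕ)
open import Data.Fin using (Fin)
open import Function using (_∘_; id; _↔_)
open import Relation.Binary.PropositionalEquality using (_≡_; _≢_)
open import Relation.Nullary using (does)
open import Axiom.ExcludedMiddle using (ExcludedMiddle)

-- An endofunctor on Set (laws stated pointwise; map-cong records that
-- F acts on functions, i.e. respects extensional equality).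
record SetFunctor : Set₁ where
  field
    F₀       : Set → Set
    map      : {A B : Set} → (A → B) → F₀ A → F₀ B
    map-id   : {A : Set} (x : F₀ A) → map id x ≡ x
    map-∘    : {A B C : Set} (f : A → B) (g : B → C) (x : F₀ A) →
               map (g ∘ f) x ≡ map g (map f x)
    map-cong : {A B : Set} {f g : A → B} → (∀ a → f a ≡ g a) →
               (x : F₀ A) → map f x ≡ map g x

Finite : Set → Set
Finite A = Σ ℕ (λ n → A ↔ Fin n)

module _ (𝔽 : SetFunctor) where
  open SetFunctor 𝔽

  F2 : Set
  F2 = F₀ Bool

  EvalMap : Set
  EvalMap = F2 → Bool

  Lift : {Y : Set} (R : Y → Y → Set) → F₀ Y → F₀ Y → Set
  Lift {Y} R t0 t1 =
    Σ (F₀ (Σ (Y × Y) (λ p → R (proj₁ p) (proj₂ p)))) λ t →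
      (map (proj₁ ∘ proj₁) t ≡ t0) × (map (proj₂ ∘ proj₁) t ≡ t1)

  _≤F_ : F2 → F2 → Set
  _≤F_ = Lift _≤ᵇ_

  Separating : (EvalMap → Set) → Set₁
  Separating Λ = (X : Set) (t0 t1 : F₀ X) → t0 ≢ t1 →
    Σ EvalMap λ l → Λ l × Σ (X → Bool) λ p → l (map p t0) ≢ l (map p t1)

  StronglySeparating : (EvalMap → Set) → Set₁
  StronglySeparating Λ = Separating Λ ×
    ((t0 t1 : F2) → t0 ≢ t1 → Σ EvalMap λ l → Λ l × l t0 ≢ l t1)

  data Formula : Set₁ where
    ⋀    : (I : Set) → (I → Formula) → Formula
    ¬'   : Formula → Formula
    [_]_ : EvalMap → Formula → Formula

  ⋁ : (I : Set) → (I → Formula) → Formula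
  ⋁ I Φ = ¬' (⋀ I (λ i → ¬' (Φ i)))

  _∧'_ : Formula → Formula → Formula
  φ ∧' ψ = ⋀ Bool (λ b → if b then φ else ψ)

  -- Semantics into 2 = Bool needs excluded middle (infinitary conjunction).
  module Semantics (lem : ExcludedMiddle 0ℓ) where

    ⟦_⟧ : Formula → {X : Set} → (X → F₀ X) → X → Bool
    ⟦ ⋀ I Φ ⟧ α x   = does (lem {(i : I) → ⟦ Φ i ⟧ α x ≡ true})
    ⟦ ¬' φ ⟧ α x    = not (⟦ φ ⟧ α x)
    ⟦ [ l ] φ ⟧ α x = l (map (⟦ φ ⟧ α) (α x))

    _≡ᶠ_ : Formula → Formula → Set₁
    φ ≡ᶠ ψ = (X : Set) (α : X → F₀ X) (x : X) → ⟦ φ ⟧ α x ≡ ⟦ ψ ⟧ α x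

    cone : F2 → EvalMap
    cone v u = does (lem {v ≤F u})

  coneExpansion : (EvalMap → Set) → F2 → Formula → Formula
  coneExpansion Λ v φ =
    ⋁ (Σ F2 (λ u → v ≤F u)) λ uv →
      ⋀ (Σ EvalMap (λ l → Λ l × (l (proj₁ uv) ≡ true))) (λ lp → [ proj₁ lp ] φ)
      ∧' ⋀ (Σ EvalMap (λ l → Λ l × (l (proj₁ uv) ≡ false))) (λ lp → ¬' ([ proj₁ lp ] φ))

module Submission where

-- Fix a coalgebra α : X → FX, a state x and a formula φ, and put
-- w = F⟦φ⟧(α x) ∈ F2, the "one-step profile" of φ at x.  Every modality is
-- evaluated on w: [λ]φ holds at x iff λ(w) = 1.  Hence the diagram formula
--   δ_u = ⋀_{λ ∈ Λ_u} [λ]φ ∧ ⋀_{λ ∈ Λ∖Λ_u} ¬[λ]φ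
-- holds at x iff every λ ∈ Λ takes the same value on u and on w, and since
-- Λ separates the points of F2 this happens iff u = w.  So the disjunction
-- of the δ_u over the cone above v holds iff w lies in that cone, which is
-- exactly the meaning of [↑v]φ at x.

open import Defs
open import Level using (0ℓ)
open import Axiom.ExcludedMiddle using (ExcludedMiddle)
open import Data.Bool using (Bool; true; false; not; if_then_else_)
open import Data.Bool.Properties using (⇔→≡; ¬-not)
open import Data.Product using (Σ; _×_; _,_; proj₁; proj₂; map₂)
open import Function using (_⇔_; mk⇔; Equivalence)
open import Function.Properties.Equivalence using (⇔-setoid)
open import Relation.Nullary using (¬_; yes; no; does; contradiction)
open import Relation.Binary.PropositionalEquality
  using (_≡_; _≢_; refl; sym; trans; cong)
import Relation.Binary.Reasoning.Setoid as SetoidReasoning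

open Equivalence using (to; from)

not-true : {b : Bool} → not b ≡ true ⇔ b ≡ false
not-true {true}  = mk⇔ (λ ()) (λ ())
not-true {false} = mk⇔ (λ _ → refl) (λ _ → refl)

agree-on-values : {b c : Bool} →
  (b ≡ true → c ≡ true) → (b ≡ false → c ≡ false) → b ≡ c
agree-on-values {true}  t _ = sym (t refl)
agree-on-values {false} _ f = sym (f refl)

SeparatesPoints : {A : Set} → ((A → Bool) → Set) → Set
SeparatesPoints {A} Λ =
  (a b : A) → a ≢ b → Σ (A → Bool) λ l → Λ l × l a ≢ l b

-- The right-hand side of Proposition 6 is the
-- disjunction of the δ_u over the cone above v (definitionally).
diagram : (𝔽 : SetFunctor) → (EvalMap 𝔽 → Set) → Formula 𝔽 → F2 𝔽 → Formula 𝔽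
diagram 𝔽 Λ φ u = _∧'_ 𝔽
  (⋀ (Σ (EvalMap 𝔽) (λ l → Λ l × (l u ≡ true)))  (λ lp → [ proj₁ lp ] φ))
  (⋀ (Σ (EvalMap 𝔽) (λ l → Λ l × (l u ≡ false))) (λ lp → ¬' ([ proj₁ lp ] φ)))

module _ (lem : ExcludedMiddle 0ℓ) where

  decide-true : {P : Set} → does (lem {P}) ≡ true ⇔ P
  decide-true {P} with lem {P}
  ... | yes p = mk⇔ (λ _ → p) (λ _ → refl)
  ... | no ¬p = mk⇔ (λ ()) (λ p → contradiction p ¬p)

  decide-false : {P : Set} → does (lem {P}) ≡ false ⇔ (¬ P)
  decide-false {P} with lem {P}
  ... | yes p = mk⇔ (λ ()) (λ ¬p → contradiction p ¬p)
  ... | no ¬p = mk⇔ (λ _ → ¬p) (λ _ → refl)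

  separated-agreement : {A : Set} {Λ : (A → Bool) → Set} → SeparatesPoints Λ →
    {a b : A} → (∀ l → Λ l → l a ≡ l b) → a ≡ b
  separated-agreement sep {a} {b} agree with lem {a ≡ b}
  ... | yes a≡b = a≡b
  ... | no  a≢b with sep a b a≢b
  ...   | l , Λl , la≢lb = contradiction (agree l Λl) la≢lb

  module _ (𝔽 : SetFunctor) where
    open SetFunctor 𝔽
    open Semantics 𝔽 lem

    module _ {X : Set} (α : X → F₀ X) (x : X) where

      ⋀-true : {I : Set} (Φ : I → Formula 𝔽) →
        ⟦ ⋀ I Φ ⟧ α x ≡ true ⇔ (∀ i → ⟦ Φ i ⟧ α x ≡ true)
      ⋀-true _ = decide-true

      ∧-true : (φ ψ : Formula 𝔽) →
        ⟦ _∧'_ 𝔽 φ ψ ⟧ α x ≡ true ⇔ (⟦ φ ⟧ α x ≡ true × ⟦ ψ ⟧ α x ≡ true)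
      ∧-true φ ψ = mk⇔ (λ h → to (⋀-true both) h true , to (⋀-true both) h false)
                       (λ { (p , q) → from (⋀-true both) λ { true → p ; false → q } })
        where
        both : Bool → Formula 𝔽
        both b = if b then φ else ψ

      ⋁-true : {I : Set} (Φ : I → Formula 𝔽) →
        ⟦ ⋁ 𝔽 I Φ ⟧ α x ≡ true ⇔ Σ I (λ i → ⟦ Φ i ⟧ α x ≡ true)
      ⋁-true {I} Φ = mk⇔ witness refute
        where
        noneTrue : Set
        noneTrue = ∀ i → not (⟦ Φ i ⟧ α x) ≡ true

        witness : ⟦ ⋁ 𝔽 I Φ ⟧ α x ≡ true → Σ I (λ i → ⟦ Φ i ⟧ α x ≡ true)
        witness h with lem {Σ I (λ i → ⟦ Φ i ⟧ α x ≡ true)}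
        ... | yes found = found
        ... | no  none  = contradiction
          (λ i → from not-true (¬-not λ Φi → none (i , Φi)))
          (to (decide-false {noneTrue}) (to not-true h))

        refute : Σ I (λ i → ⟦ Φ i ⟧ α x ≡ true) → ⟦ ⋁ 𝔽 I Φ ⟧ α x ≡ true
        refute (i , Φi) = from not-true (from (decide-false {noneTrue})
          λ allFalse → false≢true (trans (cong not (sym Φi)) (allFalse i)))
          where
          false≢true : false ≢ true
          false≢true ()

    profile : {X : Set} → (X → F₀ X) → Formula 𝔽 → X → F2 𝔽
    profile α φ x = map (⟦ φ ⟧ α) (α x)

    diagram-true : {Λ : EvalMap 𝔽 → Set} → SeparatesPoints Λ →
      {X : Set} (α : X → F₀ X) (x : X) (φ : Formula 𝔽) (u : F2 𝔽) →
      ⟦ diagram 𝔽 Λ φ u ⟧ α x ≡ true ⇔ u ≡ profile α φ x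
    diagram-true {Λ} sep α x φ u = mk⇔ equal-profile profile-satisfies
      where
      positive : Σ (EvalMap 𝔽) (λ l → Λ l × (l u ≡ true)) → Formula 𝔽
      positive (l , _) = [ l ] φ

      negative : Σ (EvalMap 𝔽) (λ l → Λ l × (l u ≡ false)) → Formula 𝔽
      negative (l , _) = ¬' ([ l ] φ)

      equal-profile : ⟦ diagram 𝔽 Λ φ u ⟧ α x ≡ true → u ≡ profile α φ x
      equal-profile h = separated-agreement sep λ l Λl →
        agree-on-values (λ lu → to (⋀-true α x positive) holdsPositive (l , Λl , lu))
                        (λ lu → to not-true (to (⋀-true α x negative) holdsNegative (l , Λl , lu)))
        where
        holdsPositive : ⟦ ⋀ _ positive ⟧ α x ≡ true
        holdsPositive = proj₁ (to (∧-true α x _ _) h)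
        holdsNegative : ⟦ ⋀ _ negative ⟧ α x ≡ true
        holdsNegative = proj₂ (to (∧-true α x _ _) h)

      profile-satisfies : u ≡ profile α φ x → ⟦ diagram 𝔽 Λ φ u ⟧ α x ≡ true
      profile-satisfies refl = from (∧-true α x _ _)
        ( from (⋀-true α x positive) (λ { (_ , _ , lw) → lw })
        , from (⋀-true α x negative) (λ { (_ , _ , lw) → from not-true lw }) )

proposition6 : (𝔽 : SetFunctor) (lem : ExcludedMiddle 0ℓ) →
    Finite (F2 𝔽) → (Λ : EvalMap 𝔽 → Set) → StronglySeparating 𝔽 Λ →
    (v : F2 𝔽) (φ : Formula 𝔽) →
    Semantics._≡ᶠ_ 𝔽 lem ([_]_ {𝔽} (Semantics.cone 𝔽 lem v) φ) (coneExpansion 𝔽 Λ v φ)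
proposition6 𝔽 lem _ Λ (_ , separates) v φ X α x = ⇔→≡ (begin
  cone v w ≡ true                                   ≈⟨ decide-true lem ⟩
  _≤F_ 𝔽 v w                                        ≈⟨ mk⇔ (λ v≤w → (w , v≤w) , refl)
                                                           (λ { ((_ , v≤u) , refl) → v≤u }) ⟩
  Σ (Σ (F2 𝔽) (_≤F_ 𝔽 v)) (λ uv → proj₁ uv ≡ w)     ≈⟨ mk⇔ (map₂ (from (diagram-true′ _)))
                                                           (map₂ (to (diagram-true′ _))) ⟩
  Σ (Σ (F2 𝔽) (_≤F_ 𝔽 v)) (λ uv → ⟦ diagram 𝔽 Λ φ (proj₁ uv) ⟧ α x ≡ true)
                                                    ≈⟨ ⋁-true lem 𝔽 α x (λ uv → diagram 𝔽 Λ φ (proj₁ uv)) ⟨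
  ⟦ coneExpansion 𝔽 Λ v φ ⟧ α x ≡ true               ∎)
  where
  open Semantics 𝔽 lem
  open SetoidReasoning (⇔-setoid 0ℓ)
  w : F2 𝔽
  w = profile lem 𝔽 α φ x
  diagram-true′ : (u : F2 𝔽) → ⟦ diagram 𝔽 Λ φ u ⟧ α x ≡ true ⇔ u ≡ w
  diagram-true′ = diagram-true lem 𝔽 separates α x φ
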